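{- Let $p\equiv 1\pmod 4$ be a prime and $M_p=(p^2-1)/8$. (i) $\sum_{a\in V}a=M_p/3$ and $\sum_{a\in V}\overline{a}=2M_p/3$. (ii) Let $V_2=\{a\in V : a+\overline{a}>p/2\}$. Then $|V_2|\equiv M_p\pmod 2$.
   Context: For an integer $x$, $\{x\}_p$ denotes the least nonnegative residue of $x$ modulo $p$, and $\widetilde{x}=p-\{x\}_p$ if $\{x\}_p>p/2$, while $\widetilde{x}=\{x\}_p$ if $\{x\}_p<p/2$. Let $t=\prod_{x=1}^{(p-1)/2}x$. Let $V=\{x : 1\le x\le (p-1)/2,\ x<\widetilde{tx}\}$, and for $a\in V$ put $\overline{a}=\widetilde{ta}$. -}

module Defs where

open import Data.Nat using (ℕ; zero; suc; _+_; _*_; _∸_; _<_; _<ᵇ_)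
open import Data.Nat.DivMod using (_/_; _%_)
open import Data.Nat using (_!)
open import Data.Bool using (Bool; if_then_else_)
open import Data.List using (List; filter; map; length; upTo)
open import Data.Nat using (_<?_)

half : ℕ → ℕ
half p = (p ∸ 1) / 2

range1h : ℕ → List ℕ
range1h p = map suc (upTo (half p))

tval : ℕ → ℕ
tval p = (half p) !

-- x̃ : absolute least residue of x modulo p (for x ≥ 0, p odd > 0)
tilde : (p : ℕ) → .{{_ : Data.Nat.NonZero p}} → ℕ → ℕ
tilde p x = if p <ᵇ 2 * (x % p) then p ∸ (x % p) else x % p

bar : (p : ℕ) → .{{_ : Data.Nat.NonZero p}} → ℕ → ℕ
bar p a = tilde p (tval p * a)

V : (p : ℕ) → .{{_ : Data.Nat.NonZero p}} → List ℕ
V p = filter (λ x → x <? bar p x) (range1h p)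

-- V₂ = { a ∈ V : a + ā > p/2 }   (a + ā > p/2  ⇔  p < 2(a + ā))
V₂ : (p : ℕ) → .{{_ : Data.Nat.NonZero p}} → List ℕ
V₂ p = filter (λ a → p <? 2 * (a + bar p a)) (V p)

M : ℕ → ℕ
M p = (p * p ∸ 1) / 8

module Submission where

-- Let p = 4k + 1, h = (p - 1)/2 and t = h!; Wilson's theorem gives t² ≡ -1 (mod p).
-- Then f x = (t x)~ is a fixed-point-free involution of [1, h] (so V picks one point of each
-- orbit {a, ā}), and g x = ((1 + t) x)~ is a permutation of [1, h] sending each pair {x, f x}
-- onto {|x - f x|, (x + f x)~}.  Comparing ∑ g and ∑ g² over [1, h] with the sums of
-- |x - f x| and (x + f x)~ gives two linear relations between S = ∑_{a ∈ V} a, ∑ x, ∑ x² and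
-- the pairs with x + f x > p/2, where (x + f x)~ = p - (x + f x).  Eliminating the latter
-- leaves 2pS + ∑ x² = p ∑ x, i.e. 3S = ∑ x = M_p; the first relation, halved and read
-- modulo 2, shows that |V₂| ≡ M_p.

open import Algebra.Bundles using (CommutativeMonoid)
open import Algebra.Core using (Op₂)
open import Algebra.Structures using (IsCommutativeMonoid)
open import Data.Bool using (true; false)
open import Data.Empty using (⊥-elim)
open import Data.Integer as ℤ using (ℤ)
import Data.Integer.Properties as ℤₚ
open import Data.Integer.Tactic.RingSolver using (solve-∀)
open import Data.List using ([]; _∷_; _∷ʳ_; map; filter; length; upTo)
open import Data.List.Properties using (upTo-∷ʳ; map-∘; map-id)
open import Data.Nat as ℕ
  using (ℕ; NonZero; zero; suc; pred; _+_; _*_; _∸_; _⊓_; ∣_-_∣; _!; _≤_; _<_; z≤n; s≤s; _≟_; _<?_)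
open import Data.Nat.Divisibility using (_∣_; m%n≡0⇒n∣m; ∣⇒≤; >⇒∤)
open import Data.Nat.DivMod using (_/_; _%_; m≡m%n+[m/n]*n; [m+kn]%n≡m%n; m<n⇒m%n≡m; m%n<n; m*n/n≡m)
open import Data.Nat.GCD using (module Bézout; module GCD)
open import Data.Nat.ListAction using (sum)
open import Data.Nat.Primality using (Prime; prime⇒irreducible; prime⇒nonTrivial; euclidsLemma)
import Data.Nat.Properties as ℕ
import Data.Nat.Tactic.RingSolver as ℕ-Solver
open import Data.Product using (_×_; _,_; proj₂)
open import Data.Sum using (_⊎_; inj₁; inj₂)
open import Relation.Binary.Bundles using (Setoid)
open import Relation.Binary.PropositionalEquality
import Relation.Binary.Reasoning.Setoid as SetoidReasoning
open import Relation.Nullary using (Dec; yes; no; ¬_)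
open import Relation.Nullary.Reflects using (ofʸ; ofⁿ)
open import Relation.Unary using (Decidable)

open import Defs using (tilde; half; tval; bar; range1h; V; V₂; M)

infix 4 _∈[1,_]
_∈[1,_] : ℕ → ℕ → Set
x ∈[1, n ] = 1 ≤ x × x ≤ n

∈[1,suc] : ∀ {x n} → x ∈[1, n ] → x ∈[1, suc n ]
∈[1,suc] (1≤x , x≤n) = 1≤x , ℕ.m≤n⇒m≤1+n x≤n

record IsBijectionOn (n : ℕ) (g g⁻¹ : ℕ → ℕ) : Set where
  field
    closed    : ∀ {x} → x ∈[1, n ] → g x ∈[1, n ]
    closed⁻¹  : ∀ {x} → x ∈[1, n ] → g⁻¹ x ∈[1, n ]
    inverseˡ  : ∀ {x} → x ∈[1, n ] → g⁻¹ (g x) ≡ x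
    inverseʳ  : ∀ {x} → x ∈[1, n ] → g (g⁻¹ x) ≡ x

record IsInvolutionOn (n : ℕ) (f : ℕ → ℕ) : Set where
  field
    closed     : ∀ {x} → x ∈[1, n ] → f x ∈[1, n ]
    involutive : ∀ {x} → x ∈[1, n ] → f (f x) ≡ x

  isBijectionOn : IsBijectionOn n f f
  isBijectionOn = record
    { closed = closed ; closed⁻¹ = closed ; inverseˡ = involutive ; inverseʳ = involutive }

module BigOperator {A : Set} {_∙_ : Op₂ A} {ε : A}
                   (isCM : IsCommutativeMonoid _≡_ _∙_ ε) where

  open IsCommutativeMonoid isCM using (assoc; identityˡ; identityʳ)

  commutativeMonoid : CommutativeMonoid _ _
  commutativeMonoid = record
    { Carrier = A ; _≈_ = _≡_ ; _∙_ = _∙_ ; ε = ε ; isCommutativeMonoid = isCM }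

  open import Algebra.Properties.CommutativeSemigroup
    (CommutativeMonoid.commutativeSemigroup commutativeMonoid) using (interchange)

  ∏ : ℕ → (ℕ → A) → A
  ∏ zero    F = ε
  ∏ (suc n) F = ∏ n F ∙ F (suc n)

  ∏-cong : ∀ n {F G : ℕ → A} → (∀ x → x ∈[1, n ] → F x ≡ G x) → ∏ n F ≡ ∏ n G
  ∏-cong zero    eq = refl
  ∏-cong (suc n) eq =
    cong₂ _∙_ (∏-cong n (λ x x∈ → eq x (∈[1,suc] x∈))) (eq (suc n) (s≤s z≤n , ℕ.≤-refl))

  ∏-ε : ∀ n → ∏ n (λ _ → ε) ≡ ε
  ∏-ε zero    = refl
  ∏-ε (suc n) = trans (cong (_∙ ε) (∏-ε n)) (identityʳ ε)

  ∏-distrib : ∀ n (F G : ℕ → A) → ∏ n (λ x → F x ∙ G x) ≡ ∏ n F ∙ ∏ n G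
  ∏-distrib zero    F G = sym (identityˡ ε)
  ∏-distrib (suc n) F G =
    trans (cong (_∙ (F (suc n) ∙ G (suc n))) (∏-distrib n F G)) (interchange _ _ _ _)

  ∏-comm : ∀ m n (H : ℕ → ℕ → A) → ∏ m (λ x → ∏ n (H x)) ≡ ∏ n (λ y → ∏ m (λ x → H x y))
  ∏-comm zero    n H = sym (∏-ε n)
  ∏-comm (suc m) n H =
    trans (cong (_∙ ∏ n (H (suc m))) (∏-comm m n H)) (sym (∏-distrib n _ (H (suc m))))

  ∏-+ : ∀ m n (F : ℕ → A) → ∏ (m + n) F ≡ ∏ m F ∙ ∏ n (λ x → F (m + x))
  ∏-+ m zero    F = trans (cong (λ k → ∏ k F) (ℕ.+-identityʳ m)) (sym (identityʳ _))
  ∏-+ m (suc n) F = begin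
    ∏ (m + suc n) F                                  ≡⟨ cong (λ k → ∏ k F) (ℕ.+-suc m n) ⟩
    ∏ (m + n) F ∙ F (suc (m + n))                    ≡⟨ cong₂ _∙_ (∏-+ m n F) (cong F (sym (ℕ.+-suc m n))) ⟩
    (∏ m F ∙ ∏ n (λ x → F (m + x))) ∙ F (m + suc n)  ≡⟨ assoc _ _ _ ⟩
    ∏ m F ∙ ∏ (suc n) (λ x → F (m + x))              ∎
    where open ≡-Reasoning

  when : {P : Set} → Dec P → A → A
  when (yes _) v = v
  when (no _)  _ = ε

  ∏-when-≡ : ∀ n c (F : ℕ → A) → c ∈[1, n ] → ∏ n (λ y → when (c ≟ y) (F y)) ≡ F c
  ∏-when-≡ zero    c F (1≤c , c≤0) = ⊥-elim (ℕ.<⇒≱ 1≤c c≤0)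
  ∏-when-≡ (suc n) c F (1≤c , c≤1+n) with c ≟ suc n
  ... | yes refl = trans (cong (_∙ F (suc n)) (trans (∏-cong n absent) (∏-ε n))) (identityˡ _)
    where
    absent : ∀ y → y ∈[1, n ] → when (suc n ≟ y) (F y) ≡ ε
    absent y (_ , y≤n) with suc n ≟ y
    ... | yes refl = ⊥-elim (ℕ.<-irrefl refl y≤n)
    ... | no _     = refl
  ... | no c≢1+n =
    trans (cong (_∙ ε) (∏-when-≡ n c F (1≤c , ℕ.≤-pred (ℕ.≤∧≢⇒< c≤1+n c≢1+n)))) (identityʳ _)

  -- Expand each F (g x) as a product of indicators over y, swap the two products and collapse along g⁻¹.
  ∏-reindex : ∀ n {g g⁻¹ : ℕ → ℕ} (F : ℕ → A) → IsBijectionOn n g g⁻¹ →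
              ∏ n (λ x → F (g x)) ≡ ∏ n F
  ∏-reindex n {g} {g⁻¹} F bij = begin
    ∏ n (λ x → F (g x))                                  ≡⟨ ∏-cong n (λ x x∈ → sym (∏-when-≡ n (g x) F (closed x∈))) ⟩
    ∏ n (λ x → ∏ n (λ y → when (g x ≟ y) (F y)))         ≡⟨ ∏-comm n n _ ⟩
    ∏ n (λ y → ∏ n (λ x → when (g x ≟ y) (F y)))         ≡⟨ ∏-cong n (λ y y∈ → ∏-cong n (λ x x∈ → swap x y x∈ y∈)) ⟩
    ∏ n (λ y → ∏ n (λ x → when (g⁻¹ y ≟ x) (F y)))       ≡⟨ ∏-cong n (λ y y∈ → ∏-when-≡ n (g⁻¹ y) (λ _ → F y) (closed⁻¹ y∈)) ⟩
    ∏ n F                                                ∎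
    where
    open ≡-Reasoning
    open IsBijectionOn bij
    swap : ∀ x y → x ∈[1, n ] → y ∈[1, n ] → when (g x ≟ y) (F y) ≡ when (g⁻¹ y ≟ x) (F y)
    swap x y x∈ y∈ with g x ≟ y | g⁻¹ y ≟ x
    ... | yes _    | yes _    = refl
    ... | no _     | no _     = refl
    ... | yes gx≡y | no  g⁻¹y≢x = ⊥-elim (g⁻¹y≢x (trans (cong g⁻¹ (sym gx≡y)) (inverseˡ x∈)))
    ... | no  gx≢y | yes g⁻¹y≡x = ⊥-elim (gx≢y (trans (cong g (sym g⁻¹y≡x)) (inverseʳ y∈)))

  when-trichotomy : ∀ x y v → (when (x <? y) v ∙ when (y <? x) v) ∙ when (x ≟ y) v ≡ v
  when-trichotomy x y v with x <? y | y <? x | x ≟ y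
  ... | yes x<y | yes y<x | _        = ⊥-elim (ℕ.<-asym x<y y<x)
  ... | yes x<y | _       | yes refl = ⊥-elim (ℕ.<-irrefl refl x<y)
  ... | _       | yes y<x | yes refl = ⊥-elim (ℕ.<-irrefl refl y<x)
  ... | no x≮y  | no y≮x  | no x≢y   = ⊥-elim (x≢y (ℕ.≤-antisym (ℕ.≮⇒≥ y≮x) (ℕ.≮⇒≥ x≮y)))
  ... | yes _   | no _    | no _     = trans (identityʳ _) (identityʳ v)
  ... | no _    | yes _   | no _     = trans (identityʳ _) (identityˡ v)
  ... | no _    | no _    | yes _    = trans (cong (_∙ v) (identityˡ ε)) (identityˡ v)

  ∏-involution : ∀ n {f : ℕ → ℕ} (F : ℕ → A) → IsInvolutionOn n f →
    ∏ n F ≡ (∏ n (λ x → when (x <? f x) (F x)) ∙ ∏ n (λ x → when (x <? f x) (F (f x))))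
            ∙ ∏ n (λ x → when (x ≟ f x) (F x))
  ∏-involution n {f} F inv = begin
    ∏ n F
      ≡⟨ ∏-cong n (λ x _ → sym (when-trichotomy x (f x) (F x))) ⟩
    ∏ n (λ x → (less x ∙ greater x) ∙ fixed x)
      ≡⟨ ∏-distrib n _ fixed ⟩
    ∏ n (λ x → less x ∙ greater x) ∙ ∏ n fixed
      ≡⟨ cong (_∙ ∏ n fixed) (∏-distrib n less greater) ⟩
    (∏ n less ∙ ∏ n greater) ∙ ∏ n fixed
      ≡⟨ cong (λ z → (∏ n less ∙ z) ∙ ∏ n fixed) greater-reindexed ⟩
    (∏ n less ∙ ∏ n (λ x → when (x <? f x) (F (f x)))) ∙ ∏ n fixed ∎
    where
    open ≡-Reasoning
    open IsInvolutionOn inv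
    less greater fixed : ℕ → A
    less    x = when (x <? f x) (F x)
    greater x = when (f x <? x) (F x)
    fixed   x = when (x ≟ f x) (F x)
    greater-reindexed : ∏ n greater ≡ ∏ n (λ x → when (x <? f x) (F (f x)))
    greater-reindexed = begin
      ∏ n greater                               ≡⟨ ∏-reindex n greater isBijectionOn ⟨
      ∏ n (λ x → greater (f x))                 ≡⟨ ∏-cong n (λ x x∈ → cong (λ y → when (y <? f x) (F (f x))) (involutive x∈)) ⟩
      ∏ n (λ x → when (x <? f x) (F (f x)))     ∎

  ∏-fixedPointFree : ∀ n {f : ℕ → ℕ} (F : ℕ → A) → IsInvolutionOn n f →
    (∀ {x} → x ∈[1, n ] → x ≢ f x) →
    ∏ n F ≡ ∏ n (λ x → when (x <? f x) (F x)) ∙ ∏ n (λ x → when (x <? f x) (F (f x)))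
  ∏-fixedPointFree n {f} F inv fpf = begin
    ∏ n F                                  ≡⟨ ∏-involution n F inv ⟩
    (∏ n less ∙ ∏ n partner) ∙ ∏ n fixed   ≡⟨ cong ((∏ n less ∙ ∏ n partner) ∙_) (trans (∏-cong n no-fixed) (∏-ε n)) ⟩
    (∏ n less ∙ ∏ n partner) ∙ ε           ≡⟨ identityʳ _ ⟩
    ∏ n less ∙ ∏ n partner                 ∎
    where
    open ≡-Reasoning
    less partner fixed : ℕ → A
    less    x = when (x <? f x) (F x)
    partner x = when (x <? f x) (F (f x))
    fixed   x = when (x ≟ f x) (F x)
    no-fixed : ∀ x → x ∈[1, n ] → fixed x ≡ ε
    no-fixed x x∈ with x ≟ f x
    ... | yes x≡fx = ⊥-elim (fpf x∈ x≡fx)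
    ... | no _     = refl

  ∏-symmetric : ∀ n {f : ℕ → ℕ} (F : ℕ → A) → IsInvolutionOn n f →
    (∀ {x} → x ∈[1, n ] → x ≢ f x) → (∀ {x} → x ∈[1, n ] → F (f x) ≡ F x) →
    ∏ n F ≡ ∏ n (λ x → when (x <? f x) (F x)) ∙ ∏ n (λ x → when (x <? f x) (F x))
  ∏-symmetric n {f} F inv fpf F∘f≡F =
    trans (∏-fixedPointFree n F inv fpf)
          (cong (∏ n (λ x → when (x <? f x) (F x)) ∙_)
                (∏-cong n (λ x x∈ → cong (when (x <? f x)) (F∘f≡F x∈))))

module ℕ-Product where

  open BigOperator ℕ.*-1-isCommutativeMonoid public

  ∏-identity≡! : ∀ n → ∏ n (λ x → x) ≡ n !
  ∏-identity≡! zero    = refl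
  ∏-identity≡! (suc n) = trans (cong (_* suc n) (∏-identity≡! n)) (ℕ.*-comm (n !) (suc n))

module ℕ-Sum where

  open BigOperator ℕ.+-0-isCommutativeMonoid public
    using (when)
    renaming ( ∏ to ∑ ; ∏-cong to ∑-cong ; ∏-distrib to ∑-distrib ; ∏-reindex to ∑-reindex
             ; ∏-fixedPointFree to ∑-fixedPointFree ; ∏-symmetric to ∑-symmetric )

  *-distribˡ-∑ : ∀ c n (F : ℕ → ℕ) → c * ∑ n F ≡ ∑ n (λ x → c * F x)
  *-distribˡ-∑ c zero    F = ℕ.*-zeroʳ c
  *-distribˡ-∑ c (suc n) F = trans (ℕ.*-distribˡ-+ c (∑ n F) (F (suc n)))
                                   (cong (_+ c * F (suc n)) (*-distribˡ-∑ c n F))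

  ∑-identity : ∀ n → 2 * ∑ n (λ x → x) ≡ n * suc n
  ∑-identity zero    = refl
  ∑-identity (suc n) = trans (ℕ.*-distribˡ-+ 2 (∑ n (λ x → x)) (suc n))
                             (trans (cong (_+ 2 * suc n) (∑-identity n)) (step n))
    where step : ∀ n → n * suc n + 2 * suc n ≡ suc n * suc (suc n)
          step = ℕ-Solver.solve-∀

  ∑-square : ∀ n → 6 * ∑ n (λ x → x * x) ≡ n * suc n * (1 + 2 * n)
  ∑-square zero    = refl
  ∑-square (suc n) = trans (ℕ.*-distribˡ-+ 6 (∑ n (λ x → x * x)) (suc n * suc n))
                           (trans (cong (_+ 6 * (suc n * suc n)) (∑-square n)) (step n))
    where step : ∀ n → n * suc n * (1 + 2 * n) + 6 * (suc n * suc n)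
                       ≡ suc n * suc (suc n) * (1 + 2 * suc n)
          step = ℕ-Solver.solve-∀

  sum-map-∷ʳ : ∀ (G : ℕ → ℕ) xs x → sum (map G (xs ∷ʳ x)) ≡ sum (map G xs) + G x
  sum-map-∷ʳ G []       x = ℕ.+-comm (G x) 0
  sum-map-∷ʳ G (y ∷ xs) x = trans (cong (G y +_) (sum-map-∷ʳ G xs x)) (sym (ℕ.+-assoc (G y) _ (G x)))

  sum-upTo : ∀ n (F : ℕ → ℕ) → sum (map (λ x → F (suc x)) (upTo n)) ≡ ∑ n F
  sum-upTo zero    F = refl
  sum-upTo (suc n) F = begin
    sum (map (λ x → F (suc x)) (upTo (suc n)))   ≡⟨ cong (λ xs → sum (map (λ x → F (suc x)) xs)) (upTo-∷ʳ n) ⟨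
    sum (map (λ x → F (suc x)) (upTo n ∷ʳ n))    ≡⟨ sum-map-∷ʳ (λ x → F (suc x)) (upTo n) n ⟩
    sum (map (λ x → F (suc x)) (upTo n)) + F (suc n) ≡⟨ cong (_+ F (suc n)) (sum-upTo n F) ⟩
    ∑ n F + F (suc n)                            ∎
    where open ≡-Reasoning

  sum-range : ∀ n (F : ℕ → ℕ) → sum (map F (map suc (upTo n))) ≡ ∑ n F
  sum-range n F = trans (sym (cong sum (map-∘ (upTo n)))) (sum-upTo n F)

  sum-filter : ∀ {P : ℕ → Set} (P? : Decidable P) (F : ℕ → ℕ) xs →
               sum (map F (filter P? xs)) ≡ sum (map (λ x → when (P? x) (F x)) xs)
  sum-filter P? F []       = refl
  sum-filter P? F (x ∷ xs) with P? x
  ... | yes _ = cong (F x +_) (sum-filter P? F xs)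
  ... | no _  = sum-filter P? F xs

  length-filter : ∀ {P : ℕ → Set} (P? : Decidable P) xs →
                  length (filter P? xs) ≡ sum (map (λ x → when (P? x) 1) xs)
  length-filter P? []       = refl
  length-filter P? (x ∷ xs) with P? x
  ... | yes _ = cong suc (length-filter P? xs)
  ... | no _  = length-filter P? xs

module Modular (p : ℕ) .{{_ : ℕ.NonZero p}} where

  open import Data.Integer using (+_; -[1+_]; -_) renaming (_+_ to _+ᶻ_; _*_ to _*ᶻ_)

  infix 4 _≈_ 
  record _≈_ (a b : ℤ) : Set where
    constructor mk
    field
      quotient : ℤ
      eqn      : a ≡ b +ᶻ quotient *ᶻ + p

  ≈-refl : ∀ {a} → a ≈ a
  ≈-refl {a} = mk (+ 0) (lemma a (+ p))
    where lemma : ∀ a P → a ≡ a +ᶻ + 0 *ᶻ P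
          lemma = solve-∀

  ≈-reflexive : ∀ {a b} → a ≡ b → a ≈ b
  ≈-reflexive refl = ≈-refl

  ≈-sym : ∀ {a b} → a ≈ b → b ≈ a
  ≈-sym {b = b} (mk q a≡b+qp) =
    mk (- q) (trans (lemma b q (+ p)) (cong (λ z → z +ᶻ (- q) *ᶻ + p) (sym a≡b+qp)))
    where lemma : ∀ b q P → b ≡ b +ᶻ q *ᶻ P +ᶻ (- q) *ᶻ P
          lemma = solve-∀

  ≈-trans : ∀ {a b c} → a ≈ b → b ≈ c → a ≈ c
  ≈-trans {c = c} (mk q refl) (mk r refl) = mk (r +ᶻ q) (lemma c r q (+ p))
    where lemma : ∀ c r q P → c +ᶻ r *ᶻ P +ᶻ q *ᶻ P ≡ c +ᶻ (r +ᶻ q) *ᶻ P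
          lemma = solve-∀

  ≈-setoid : Setoid _ _
  ≈-setoid = record
    { Carrier = ℤ ; _≈_ = _≈_
    ; isEquivalence = record { refl = ≈-refl ; sym = ≈-sym ; trans = ≈-trans } }

  module ≈-Reasoning = SetoidReasoning ≈-setoid

  +-cong : ∀ {a b c d} → a ≈ b → c ≈ d → a +ᶻ c ≈ b +ᶻ d
  +-cong {b = b} {d = d} (mk q refl) (mk r refl) = mk (q +ᶻ r) (lemma b d q r (+ p))
    where lemma : ∀ b d q r P → b +ᶻ q *ᶻ P +ᶻ (d +ᶻ r *ᶻ P) ≡ b +ᶻ d +ᶻ (q +ᶻ r) *ᶻ P
          lemma = solve-∀

  *-cong : ∀ {a b c d} → a ≈ b → c ≈ d → a *ᶻ c ≈ b *ᶻ d
  *-cong {b = b} {d = d} (mk q refl) (mk r refl) =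
    mk (q *ᶻ d +ᶻ b *ᶻ r +ᶻ q *ᶻ r *ᶻ + p) (lemma b d q r (+ p))
    where lemma : ∀ b d q r P → (b +ᶻ q *ᶻ P) *ᶻ (d +ᶻ r *ᶻ P) ≡ b *ᶻ d +ᶻ (q *ᶻ d +ᶻ b *ᶻ r +ᶻ q *ᶻ r *ᶻ P) *ᶻ P
          lemma = solve-∀

  neg-cong : ∀ {a b} → a ≈ b → - a ≈ - b
  neg-cong {b = b} (mk q refl) = mk (- q) (lemma b q (+ p))
    where lemma : ∀ b q P → - (b +ᶻ q *ᶻ P) ≡ - b +ᶻ (- q) *ᶻ P
          lemma = solve-∀

  +-cast : ∀ a b → + (a + b * p) ≡ + a +ᶻ + b *ᶻ + p
  +-cast a b = trans (ℤₚ.pos-+ a (b * p)) (cong (λ z → + a +ᶻ z) (ℤₚ.pos-* b p))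

  ≈-complement : ∀ a b c → a + b ≡ c * p → + b ≈ - + a
  ≈-complement a b c a+b≡cp =
    mk (+ c) (trans (lemma (+ a) (+ b)) (cong (λ z → - + a +ᶻ z) (trans (cong +_ a+b≡cp) (ℤₚ.pos-* c p))))
    where lemma : ∀ a b → b ≡ - a +ᶻ (a +ᶻ b)
          lemma = solve-∀

  +-multiple-≈ : ∀ n k → + (n + k * p) ≈ + n
  +-multiple-≈ n k = mk (+ k) (+-cast n k)

  %-≈ : ∀ m → + (m % p) ≈ + m
  %-≈ m = ≈-sym (mk (+ (m / p)) (trans (cong +_ (m≡m%n+[m/n]*n m p)) (+-cast (m % p) (m / p))))

  ≈⇒%-≡ : ∀ {m n} → + m ≈ + n → m % p ≡ n % p
  ≈⇒%-≡ {m} {n} (mk (+ q) eq) =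
    trans (cong (_% p) (ℤₚ.+-injective (trans eq (sym (+-cast n q))))) ([m+kn]%n≡m%n n q p)
  ≈⇒%-≡ {m} {n} (mk -[1+ q ] eq) =
    sym (trans (cong (_% p) (ℤₚ.+-injective (trans n≡m+[1+q]p (sym (+-cast m (suc q))))))
               ([m+kn]%n≡m%n m (suc q) p))
    where n≡m+[1+q]p = _≈_.eqn (≈-sym (mk -[1+ q ] eq))

  ≈-unique : ∀ {m n} → m < p → n < p → + m ≈ + n → m ≡ n
  ≈-unique m<p n<p m≈n =
    trans (sym (m<n⇒m%n≡m m<p)) (trans (≈⇒%-≡ m≈n) (m<n⇒m%n≡m n<p))

  ≈0⇒∣ : ∀ {n} → + n ≈ + 0 → p ∣ n
  ≈0⇒∣ {n} n≈0 = m%n≡0⇒n∣m n p (trans (≈⇒%-≡ n≈0) (m<n⇒m%n≡m (ℕ.>-nonZero⁻¹ p)))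

  infix 4 _≈±_
  _≈±_ : ℤ → ℤ → Set
  a ≈± b = a ≈ b ⊎ a ≈ - b

  ≈±-sym : ∀ {a b} → a ≈± b → b ≈± a
  ≈±-sym (inj₁ a≈b)  = inj₁ (≈-sym a≈b)
  ≈±-sym {b = b} (inj₂ a≈-b) =
    inj₂ (≈-trans (≈-reflexive (sym (ℤₚ.neg-involutive b))) (neg-cong (≈-sym a≈-b)))

  ≈±-trans : ∀ {a b c} → a ≈± b → b ≈± c → a ≈± c
  ≈±-trans (inj₁ a≈b)  (inj₁ b≈c)  = inj₁ (≈-trans a≈b b≈c)
  ≈±-trans (inj₁ a≈b)  (inj₂ b≈-c) = inj₂ (≈-trans a≈b b≈-c)
  ≈±-trans (inj₂ a≈-b) (inj₁ b≈c)  = inj₂ (≈-trans a≈-b (neg-cong b≈c))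
  ≈±-trans (inj₂ a≈-b) (inj₂ b≈-c) =
    inj₁ (≈-trans a≈-b (≈-trans (neg-cong b≈-c) (≈-reflexive (ℤₚ.neg-involutive _))))

  ≈±-setoid : Setoid _ _
  ≈±-setoid = record
    { Carrier = ℤ ; _≈_ = _≈±_
    ; isEquivalence = record { refl = inj₁ ≈-refl ; sym = ≈±-sym ; trans = ≈±-trans } }

  module ≈±-Reasoning = SetoidReasoning ≈±-setoid

  ≈±-*-cong : ∀ {a b c d} → a ≈± b → c ≈± d → a *ᶻ c ≈± b *ᶻ d
  ≈±-*-cong (inj₁ a≈b)  (inj₁ c≈d)  = inj₁ (*-cong a≈b c≈d)
  ≈±-*-cong {b = b} {d = d} (inj₁ a≈b)  (inj₂ c≈-d) =
    inj₂ (≈-trans (*-cong a≈b c≈-d) (≈-reflexive (sym (ℤₚ.neg-distribʳ-* b d))))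
  ≈±-*-cong {b = b} {d = d} (inj₂ a≈-b) (inj₁ c≈d)  =
    inj₂ (≈-trans (*-cong a≈-b c≈d) (≈-reflexive (sym (ℤₚ.neg-distribˡ-* b d))))
  ≈±-*-cong {b = b} {d = d} (inj₂ a≈-b) (inj₂ c≈-d) =
    inj₁ (≈-trans (*-cong a≈-b c≈-d) (≈-reflexive (lemma b d)))
    where lemma : ∀ b d → - b *ᶻ - d ≡ b *ᶻ d
          lemma = solve-∀

module Wilson (p : ℕ) .{{_ : ℕ.NonZero p}} (p-prime : Prime p) where

  open import Data.Integer using (+_; -_) renaming (_+_ to _+ᶻ_; _*_ to _*ᶻ_)
  open Modular p
  open ℕ-Product

  q : ℕ
  q = pred p

  1<p : 1 < p
  1<p = ℕ.nonTrivial⇒n>1 p {{prime⇒nonTrivial p-prime}}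

  q∈[1,q] : q ∈[1, q ]
  q∈[1,q] = ℕ.<⇒≤pred 1<p , ℕ.≤-refl

  ≤q⇒<p : ∀ {x} → x ≤ q → x < p
  ≤q⇒<p x≤q = subst (_ <_) (ℕ.suc-pred p) (s≤s x≤q)

  q≈-1 : + q ≈ - + 1
  q≈-1 = ≈-complement 1 q 1 (trans (ℕ.suc-pred p) (sym (ℕ.*-identityˡ p)))

  q²≈1 : + (q * q) ≈ + 1
  q²≈1 = ≈-trans (≈-reflexive (ℤₚ.pos-* q q)) (*-cong q≈-1 q≈-1)

  p∤∈[1,q] : ∀ {x} → x ∈[1, q ] → ¬ p ∣ x
  p∤∈[1,q] (1≤x , x≤q) = >⇒∤ {{ℕ.>-nonZero 1≤x}} (≤q⇒<p x≤q)

  -- In the case 1 + a x = c p the inverse is -a ≡ a q.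
  bézout-coefficient : ∀ {x} → Bézout.Lemma x p → ℕ
  bézout-coefficient (Bézout.result _ _ (Bézout.+- a _ _)) = a
  bézout-coefficient (Bézout.result _ _ (Bézout.-+ a _ _)) = a * q

  bézout-coefficient-≈ : ∀ {x} → x ∈[1, q ] → (L : Bézout.Lemma x p) →
                         + (x * bézout-coefficient L) ≈ + 1
  bézout-coefficient-≈ {x} x∈ (Bézout.result d g identity)
    with prime⇒irreducible p-prime (GCD.gcd∣n g)
  ... | inj₂ refl = ⊥-elim (p∤∈[1,q] x∈ (GCD.gcd∣m g))
  ... | inj₁ refl with identity
  ...   | Bézout.+- a c 1+cp≡ax =
    mk (+ c) (trans (cong +_ (trans (ℕ.*-comm x a) (sym 1+cp≡ax))) (+-cast 1 c))
  ...   | Bézout.-+ a c 1+ax≡cp = begin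
    + (x * (a * q))      ≡⟨ trans (cong +_ (sym (ℕ.*-assoc x a q))) (ℤₚ.pos-* (x * a) q) ⟩
    + (x * a) *ᶻ + q     ≈⟨ *-cong xa≈-1 q≈-1 ⟩
    + 1                  ∎
    where
    open ≈-Reasoning
    xa≈-1 : + (x * a) ≈ - + 1
    xa≈-1 = ≈-complement 1 (x * a) c (trans (cong suc (ℕ.*-comm x a)) 1+ax≡cp)

  inverse : ℕ → ℕ
  inverse x = bézout-coefficient (Bézout.lemma x p) % p

  inverse-≈ : ∀ {x} → x ∈[1, q ] → + (x * inverse x) ≈ + 1
  inverse-≈ {x} x∈ = begin
    + (x * (c % p))      ≡⟨ ℤₚ.pos-* x (c % p) ⟩
    + x *ᶻ + (c % p)     ≈⟨ *-cong (≈-refl {+ x}) (%-≈ c) ⟩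
    + x *ᶻ + c           ≡⟨ ℤₚ.pos-* x c ⟨
    + (x * c)            ≈⟨ bézout-coefficient-≈ x∈ (Bézout.lemma x p) ⟩
    + 1                  ∎
    where
    open ≈-Reasoning
    c = bézout-coefficient (Bézout.lemma x p)

  inverse-∈ : ∀ {x} → x ∈[1, q ] → inverse x ∈[1, q ]
  inverse-∈ {x} x∈ = ℕ.n≢0⇒n>0 inverse≢0 , ℕ.<⇒≤pred (m%n<n _ p)
    where
    inverse≢0 : inverse x ≢ 0
    inverse≢0 inverse≡0 = 0≢1 (≈-unique (ℕ.>-nonZero⁻¹ p) 1<p (begin
      + 0                  ≡⟨ cong +_ (ℕ.*-zeroʳ x) ⟨
      + (x * 0)            ≡⟨ cong (λ y → + (x * y)) inverse≡0 ⟨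
      + (x * inverse x)    ≈⟨ inverse-≈ x∈ ⟩
      + 1                  ∎))
      where
      open ≈-Reasoning
      0≢1 : 0 ≢ 1
      0≢1 ()

  inverse-unique : ∀ x {y z} → y < p → z < p → + (x * y) ≈ + 1 → + (x * z) ≈ + 1 → y ≡ z
  inverse-unique x {y} {z} y<p z<p xy≈1 xz≈1 = ≈-unique y<p z<p (begin
    + y                  ≡⟨ cong +_ (ℕ.*-identityˡ y) ⟨
    + (1 * y)            ≡⟨ ℤₚ.pos-* 1 y ⟩
    + 1 *ᶻ + y           ≈⟨ *-cong (≈-sym xz≈1) ≈-refl ⟩
    + (x * z) *ᶻ + y     ≡⟨ ℤₚ.pos-* (x * z) y ⟨
    + (x * z * y)        ≡⟨ cong +_ (rearrange x y z) ⟩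
    + (z * (x * y))      ≡⟨ ℤₚ.pos-* z (x * y) ⟩
    + z *ᶻ + (x * y)     ≈⟨ *-cong (≈-refl {+ z}) xy≈1 ⟩
    + z *ᶻ + 1           ≡⟨ ℤₚ.*-identityʳ (+ z) ⟩
    + z                  ∎)
    where
    open ≈-Reasoning
    rearrange : ∀ x y z → x * z * y ≡ z * (x * y)
    rearrange = ℕ-Solver.solve-∀

  inverse-involution : IsInvolutionOn q inverse
  inverse-involution = record { closed = inverse-∈ ; involutive = involutive }
    where
    involutive : ∀ {x} → x ∈[1, q ] → inverse (inverse x) ≡ x
    involutive {x} x∈ =
      inverse-unique (inverse x) (≤q⇒<p (proj₂ (inverse-∈ (inverse-∈ x∈)))) (≤q⇒<p (proj₂ x∈))
                     (inverse-≈ (inverse-∈ x∈))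
                     (subst (λ y → + y ≈ + 1) (ℕ.*-comm x (inverse x)) (inverse-≈ x∈))

  self-inverse : ∀ {x} → x ∈[1, q ] → + (x * x) ≈ + 1 → x ≡ 1 ⊎ x ≡ q
  self-inverse {suc m} (_ , 1+m≤q) x²≈1 with euclidsLemma m (2 + m) p-prime (≈0⇒∣ [x-1][x+1]≈0)
    where
    factor : ∀ m → m * (2 + m) + 1 ≡ suc m * suc m
    factor = ℕ-Solver.solve-∀
    [x-1][x+1]≈0 : + (m * (2 + m)) ≈ + 0
    [x-1][x+1]≈0 = begin
      + (m * (2 + m))                   ≡⟨ ℤₚ.+-identityʳ _ ⟨
      + (m * (2 + m)) +ᶻ (+ 1 +ᶻ - + 1) ≡⟨ ℤₚ.+-assoc (+ (m * (2 + m))) (+ 1) (- + 1) ⟨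
      + (m * (2 + m)) +ᶻ + 1 +ᶻ - + 1   ≡⟨ cong (_+ᶻ - + 1) (trans (sym (ℤₚ.pos-+ _ 1)) (cong +_ (factor m))) ⟩
      + (suc m * suc m) +ᶻ - + 1        ≈⟨ +-cong x²≈1 (≈-refl { - + 1}) ⟩
      + 1 +ᶻ - + 1                      ≈⟨ ≈-refl ⟩
      + 0                               ∎
      where open ≈-Reasoning
  ... | inj₁ p∣m = inj₁ (cong suc (<p∧p∣⇒≡0 (≤q⇒<p (ℕ.<⇒≤ 1+m≤q)) p∣m))
    where
    <p∧p∣⇒≡0 : ∀ {n} → n < p → p ∣ n → n ≡ 0
    <p∧p∣⇒≡0 {zero}  _   _   = refl
    <p∧p∣⇒≡0 {suc _} n<p p∣n = ⊥-elim (>⇒∤ n<p p∣n)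
  ... | inj₂ p∣2+m = inj₂ (cong pred (sym p≡2+m))
    where
    p≡2+m : p ≡ 2 + m
    p≡2+m = ℕ.≤-antisym (∣⇒≤ p∣2+m) (≤q⇒<p 1+m≤q)

  ∏-≈ : ∀ n {F G : ℕ → ℕ} → (∀ x → x ∈[1, n ] → + F x ≈ + G x) → + ∏ n F ≈ + ∏ n G
  ∏-≈ zero    F≈G = ≈-refl
  ∏-≈ (suc n) {F} {G} F≈G = begin
    + (∏ n F * F (suc n))         ≡⟨ ℤₚ.pos-* (∏ n F) (F (suc n)) ⟩
    + ∏ n F *ᶻ + F (suc n)        ≈⟨ *-cong (∏-≈ n (λ x x∈ → F≈G x (∈[1,suc] x∈))) (F≈G (suc n) (s≤s z≤n , ℕ.≤-refl)) ⟩
    + ∏ n G *ᶻ + G (suc n)        ≡⟨ ℤₚ.pos-* (∏ n G) (G (suc n)) ⟨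
    + (∏ n G * G (suc n))         ∎
    where open ≈-Reasoning

  ∏-pairs≈1 : + (∏ q (λ x → when (x <? inverse x) x) * ∏ q (λ x → when (x <? inverse x) (inverse x))) ≈ + 1
  ∏-pairs≈1 = begin
    + (∏ q below * ∏ q above)          ≡⟨ cong +_ (∏-distrib q below above) ⟨
    + ∏ q (λ x → below x * above x)    ≈⟨ ∏-≈ q pair≈1 ⟩
    + ∏ q (λ _ → 1)                    ≡⟨ cong +_ (∏-ε q) ⟩
    + 1                                ∎
    where
    open ≈-Reasoning
    below above : ℕ → ℕ
    below x = when (x <? inverse x) x
    above x = when (x <? inverse x) (inverse x)
    pair≈1 : ∀ x → x ∈[1, q ] → + (below x * above x) ≈ + 1
    pair≈1 x x∈ with x <? inverse x
    ... | yes _ = inverse-≈ x∈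
    ... | no _  = ≈-refl

  -- 1 is self-inverse too, but contributes the factor 1.
  ∏-self-inverse≡q : ∏ q (λ x → when (x ≟ inverse x) x) ≡ q
  ∏-self-inverse≡q = trans (∏-cong q only-q) (∏-when-≡ q q (λ x → x) q∈[1,q])
    where
    only-q : ∀ x → x ∈[1, q ] → when (x ≟ inverse x) x ≡ when (q ≟ x) x
    only-q x x∈ with x ≟ inverse x | q ≟ x
    ... | yes _ | yes _ = refl
    ... | no _  | no _  = refl
    ... | no x≢x⁻¹ | yes refl =
      ⊥-elim (x≢x⁻¹ (inverse-unique q (≤q⇒<p ℕ.≤-refl) (≤q⇒<p (proj₂ (inverse-∈ x∈))) q²≈1 (inverse-≈ x∈)))
    ... | yes x≡x⁻¹ | no q≢x
      with self-inverse x∈ (subst (λ y → + (x * y) ≈ + 1) (sym x≡x⁻¹) (inverse-≈ x∈))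
    ...   | inj₁ refl = refl
    ...   | inj₂ x≡q  = ⊥-elim (q≢x (sym x≡q))

  wilson : + (q !) ≈ - + 1
  wilson = begin
    + (q !)                                       ≡⟨ cong +_ (sym (∏-identity≡! q)) ⟩
    + ∏ q (λ x → x)                               ≡⟨ cong +_ (∏-involution q (λ x → x) inverse-involution) ⟩
    + ((∏ q below * ∏ q above) * ∏ q selfInverse) ≡⟨ ℤₚ.pos-* (∏ q below * ∏ q above) (∏ q selfInverse) ⟩
    + (∏ q below * ∏ q above) *ᶻ + ∏ q selfInverse ≈⟨ *-cong ∏-pairs≈1 (≈-reflexive (cong +_ ∏-self-inverse≡q)) ⟩
    + 1 *ᶻ + q                                    ≈⟨ *-cong (≈-refl {+ 1}) q≈-1 ⟩
    - + 1                                         ∎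
    where
    open ≈-Reasoning
    below above selfInverse : ℕ → ℕ
    below       x = when (x <? inverse x) x
    above       x = when (x <? inverse x) (inverse x)
    selfInverse x = when (x ≟ inverse x) x

module OddModulus (h : ℕ) where

  open import Data.Integer using (+_; -_; _^_) renaming (_+_ to _+ᶻ_; _*_ to _*ᶻ_)

  p : ℕ
  p = suc (h + h)

  open Modular p
  open ℕ-Product

  h<p : h < p
  h<p = s≤s (ℕ.m≤m+n h h)

  ≤h⇒<p : ∀ {u} → u ≤ h → u < p
  ≤h⇒<p u≤h = ℕ.≤-<-trans u≤h h<p

  2*h≡h+h : 2 * h ≡ h + h
  2*h≡h+h = cong (λ z → h + z) (ℕ.+-identityʳ h)

  double≤p⇒≤h : ∀ {r} → 2 * r ≤ p → r ≤ h
  double≤p⇒≤h {r} 2r≤p = ℕ.≮⇒≥ λ h<r → ℕ.<⇒≱ (ℕ.<-≤-trans p<2[1+h] (ℕ.*-monoʳ-≤ 2 h<r)) 2r≤p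
    where
    p<2[1+h] : p < 2 * suc h
    p<2[1+h] = ℕ.≤-reflexive (sym (lemma h))
      where lemma : ∀ h → 2 * (1 + h) ≡ 2 + (h + h)
            lemma = ℕ-Solver.solve-∀

  p<double⇒h< : ∀ {r} → p < 2 * r → h < r
  p<double⇒h< {r} p<2r = ℕ.≰⇒> λ r≤h →
    ℕ.<⇒≱ p<2r (ℕ.m≤n⇒m≤1+n (ℕ.≤-trans (ℕ.*-monoʳ-≤ 2 r≤h) (ℕ.≤-reflexive 2*h≡h+h)))

  tilde-cases : ∀ x → (p < 2 * (x % p) × tilde p x ≡ p ∸ x % p)
                    ⊎ (¬ p < 2 * (x % p) × tilde p x ≡ x % p)
  tilde-cases x with p ℕ.<ᵇ 2 * (x % p) | ℕ.<ᵇ-reflects-< p (2 * (x % p))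
  ... | true  | ofʸ p<2r = inj₁ (p<2r , refl)
  ... | false | ofⁿ p≮2r = inj₂ (p≮2r , refl)

  p∸r≤h : ∀ r → p < 2 * r → p ∸ r ≤ h
  p∸r≤h r p<2r = ℕ.m≤n+o⇒m∸n≤o p r (ℕ.+-monoˡ-≤ h (p<double⇒h< p<2r))

  p∸r≈-r : ∀ {r} → r ≤ p → + (p ∸ r) ≈ - + r
  p∸r≈-r {r} r≤p = ≈-complement r (p ∸ r) 1 (trans (ℕ.m+[n∸m]≡n r≤p) (sym (ℕ.*-identityˡ p)))

  tilde-≈± : ∀ x → + tilde p x ≈± + x
  tilde-≈± x with tilde-cases x
  ... | inj₁ (_ , eq) rewrite eq = inj₂ (≈-trans (p∸r≈-r (ℕ.<⇒≤ (m%n<n x p))) (neg-cong (%-≈ x)))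
  ... | inj₂ (_ , eq) rewrite eq = inj₁ (%-≈ x)

  tilde≤h : ∀ x → tilde p x ≤ h
  tilde≤h x with tilde-cases x
  ... | inj₁ (p<2r , eq) rewrite eq = p∸r≤h (x % p) p<2r
  ... | inj₂ (p≮2r , eq) rewrite eq = double≤p⇒≤h (ℕ.≮⇒≥ p≮2r)

  ≈-neg⇒sum≡0 : ∀ {u v} → u ≤ h → v ≤ h → + u ≈ - + v → u + v ≡ 0
  ≈-neg⇒sum≡0 {u} {v} u≤h v≤h u≈-v = ≈-unique (s≤s (ℕ.+-mono-≤ u≤h v≤h)) (s≤s z≤n) (begin
    + (u + v)      ≡⟨ ℤₚ.pos-+ u v ⟩
    + u +ᶻ + v     ≈⟨ +-cong u≈-v (≈-refl {+ v}) ⟩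
    - + v +ᶻ + v   ≡⟨ ℤₚ.+-inverseˡ (+ v) ⟩
    + 0            ∎)
    where open ≈-Reasoning

  ≈±-unique : ∀ {u v} → u ≤ h → v ≤ h → + u ≈± + v → u ≡ v
  ≈±-unique u≤h v≤h (inj₁ u≈v) = ≈-unique (≤h⇒<p u≤h) (≤h⇒<p v≤h) u≈v
  ≈±-unique {u} u≤h v≤h (inj₂ u≈-v) =
    trans (ℕ.m+n≡0⇒m≡0 u u+v≡0) (sym (ℕ.m+n≡0⇒n≡0 u u+v≡0))
    where u+v≡0 = ≈-neg⇒sum≡0 u≤h v≤h u≈-v

  tilde-unique : ∀ {u} y → u ≤ h → + u ≈± + y → tilde p y ≡ u
  tilde-unique y u≤h u≈±y = ≈±-unique (tilde≤h y) u≤h (≈±-trans (tilde-≈± y) (≈±-sym u≈±y))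

  tilde-cong : ∀ {a} b → + a ≈ + b → tilde p a ≡ tilde p b
  tilde-cong {a} b a≈b = sym (tilde-unique b (tilde≤h a) (≈±-trans (tilde-≈± a) (inj₁ a≈b)))

  tilde-small : ∀ s → ¬ p < 2 * s → tilde p s ≡ s
  tilde-small s p≮2s = tilde-unique s (double≤p⇒≤h (ℕ.≮⇒≥ p≮2s)) (inj₁ ≈-refl)

  tilde-large : ∀ s → s ≤ p → p < 2 * s → tilde p s ≡ p ∸ s
  tilde-large s s≤p p<2s = tilde-unique s (p∸r≤h s p<2s) (inj₂ (p∸r≈-r s≤p))

  mirror : ℕ → ℕ
  mirror x = suc h ∸ x

  mirror-involution : IsInvolutionOn h mirror
  mirror-involution = record
    { closed     = λ (1≤x , x≤h) → subst (1 ≤_) (sym (ℕ.+-∸-assoc 1 x≤h)) (s≤s z≤n)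
                                 , ℕ.m≤n+o⇒m∸n≤o (suc h) _ (ℕ.+-monoˡ-≤ h 1≤x)
    ; involutive = λ (_ , x≤h) → ℕ.m∸[m∸n]≡n (ℕ.m≤n⇒m≤1+n x≤h)
    }

  shift : ℕ → ℕ
  shift x = h + x

  -- h + x ≡ -(h + 1 - x) (mod p) turns the upper half of (p-1)! into a signed copy of h!.
  ∏-shift≈ : ∀ n → n ≤ h → + ∏ n shift ≈ (- + 1) ^ n *ᶻ + ∏ n mirror
  ∏-shift≈ zero    _     = ≈-refl
  ∏-shift≈ (suc n) 1+n≤h = begin
    + (∏ n shift * shift (suc n))                        ≡⟨ ℤₚ.pos-* (∏ n shift) (shift (suc n)) ⟩
    + ∏ n shift *ᶻ + shift (suc n)                       ≈⟨ *-cong (∏-shift≈ n (ℕ.<⇒≤ 1+n≤h)) shift≈-mirror ⟩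
    ((- + 1) ^ n *ᶻ + ∏ n mirror) *ᶻ - + mirror (suc n)  ≡⟨ rearrange ((- + 1) ^ n) (+ ∏ n mirror) (+ mirror (suc n)) ⟩
    (- + 1) ^ suc n *ᶻ (+ ∏ n mirror *ᶻ + mirror (suc n)) ≡⟨ cong ((- + 1) ^ suc n *ᶻ_) (ℤₚ.pos-* (∏ n mirror) (mirror (suc n))) ⟨
    (- + 1) ^ suc n *ᶻ + (∏ n mirror * mirror (suc n))   ∎
    where
    open ≈-Reasoning
    rearrange : ∀ s a b → (s *ᶻ a) *ᶻ - b ≡ (- + 1 *ᶻ s) *ᶻ (a *ᶻ b)
    rearrange = solve-∀
    mirror+shift≡p : mirror (suc n) + shift (suc n) ≡ 1 * p
    mirror+shift≡p = subst (λ z → h ∸ n + (z + suc n) ≡ 1 * suc (z + z)) (ℕ.m∸n+n≡m (ℕ.<⇒≤ 1+n≤h))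
                           (identity (h ∸ n) n)
      where identity : ∀ d n → d + (d + n + suc n) ≡ 1 * suc (d + n + (d + n))
            identity = ℕ-Solver.solve-∀
    shift≈-mirror : + shift (suc n) ≈ - + mirror (suc n)
    shift≈-mirror = ≈-complement (mirror (suc n)) (shift (suc n)) 1 mirror+shift≡p

  factorial-reflection : + ((h + h) !) ≈ (- + 1) ^ h *ᶻ + (h ! * h !)
  factorial-reflection = begin
    + ((h + h) !)                              ≡⟨ cong +_ halves ⟩
    + (h ! * ∏ h shift)                        ≡⟨ ℤₚ.pos-* (h !) (∏ h shift) ⟩
    + (h !) *ᶻ + ∏ h shift                     ≈⟨ *-cong (≈-refl {+ (h !)}) (∏-shift≈ h ℕ.≤-refl) ⟩
    + (h !) *ᶻ ((- + 1) ^ h *ᶻ + ∏ h mirror)   ≡⟨ cong (λ z → + (h !) *ᶻ ((- + 1) ^ h *ᶻ + z)) ∏-mirror ⟩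
    + (h !) *ᶻ ((- + 1) ^ h *ᶻ + (h !))        ≡⟨ rearrange (+ (h !)) ((- + 1) ^ h) ⟩
    (- + 1) ^ h *ᶻ (+ (h !) *ᶻ + (h !))        ≡⟨ cong ((- + 1) ^ h *ᶻ_) (ℤₚ.pos-* (h !) (h !)) ⟨
    (- + 1) ^ h *ᶻ + (h ! * h !)               ∎
    where
    open ≈-Reasoning
    halves : (h + h) ! ≡ h ! * ∏ h shift
    halves = trans (sym (∏-identity≡! (h + h)))
                   (trans (∏-+ h h (λ x → x)) (cong (_* ∏ h shift) (∏-identity≡! h)))
    ∏-mirror : ∏ h mirror ≡ h !
    ∏-mirror = trans (∏-reindex h (λ x → x) (IsInvolutionOn.isBijectionOn mirror-involution))
                     (∏-identity≡! h)
    rearrange : ∀ a s → a *ᶻ (s *ᶻ a) ≡ s *ᶻ (a *ᶻ a)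
    rearrange = solve-∀

module SquareRootOfMinusOne (h t : ℕ)
  (t²≈-1 : Modular._≈_ (suc (h + h)) (ℤ.+ (t * t)) ℤ.-1ℤ) where

  open import Data.Integer using (+_; -_; _-_) renaming (_+_ to _+ᶻ_; _*_ to _*ᶻ_)
  open OddModulus h
  open Modular p

  multiplier-inverse : ∀ a b {x} → + (a * b) ≈± + 1 → x ≤ h → tilde p (b * tilde p (a * x)) ≡ x
  multiplier-inverse a b {x} ab≈±1 x≤h = tilde-unique (b * tilde p (a * x)) x≤h (≈±-sym (begin
    + (b * tilde p (a * x))    ≡⟨ ℤₚ.pos-* b (tilde p (a * x)) ⟩
    + b *ᶻ + tilde p (a * x)   ≈⟨ ≈±-*-cong (inj₁ (≈-refl {+ b})) (tilde-≈± (a * x)) ⟩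
    + b *ᶻ + (a * x)           ≡⟨ trans (sym (ℤₚ.pos-* b (a * x))) (cong +_ (rearrange a b x)) ⟩
    + (a * b * x)              ≡⟨ ℤₚ.pos-* (a * b) x ⟩
    + (a * b) *ᶻ + x           ≈⟨ ≈±-*-cong ab≈±1 (inj₁ (≈-refl {+ x})) ⟩
    + 1 *ᶻ + x                 ≡⟨ ℤₚ.*-identityˡ (+ x) ⟩
    + x                        ∎))
    where
    open ≈±-Reasoning
    rearrange : ∀ a b x → b * (a * x) ≡ a * b * x
    rearrange = ℕ-Solver.solve-∀

  multiplier-∈ : ∀ a b {x} → + (a * b) ≈± + 1 → x ∈[1, h ] → tilde p (a * x) ∈[1, h ]
  multiplier-∈ a b {x} ab≈±1 (1≤x , x≤h) = ℕ.n≢0⇒n>0 image≢0 , tilde≤h (a * x)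
    where
    image≢0 : tilde p (a * x) ≢ 0
    image≢0 image≡0 = ℕ.<⇒≢ 1≤x (sym (begin
      x                          ≡⟨ multiplier-inverse a b ab≈±1 x≤h ⟨
      tilde p (b * tilde p (a * x)) ≡⟨ cong (λ y → tilde p (b * y)) image≡0 ⟩
      tilde p (b * 0)            ≡⟨ cong (tilde p) (ℕ.*-zeroʳ b) ⟩
      0                          ∎))
      where open ≡-Reasoning

  multiplier-bijection : ∀ a b → + (a * b) ≈± + 1 →
                         IsBijectionOn h (λ x → tilde p (a * x)) (λ x → tilde p (b * x))
  multiplier-bijection a b ab≈±1 = record
    { closed   = multiplier-∈ a b ab≈±1
    ; closed⁻¹ = multiplier-∈ b a ba≈±1
    ; inverseˡ = λ (_ , x≤h) → multiplier-inverse a b ab≈±1 x≤h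
    ; inverseʳ = λ (_ , x≤h) → multiplier-inverse b a ba≈±1 x≤h
    }
    where ba≈±1 = subst (λ n → + n ≈± + 1) (ℕ.*-comm a b) ab≈±1

  f : ℕ → ℕ
  f x = tilde p (t * x)

  f-involution : IsInvolutionOn h f
  f-involution = record { closed = closed ; involutive = inverseˡ }
    where open IsBijectionOn (multiplier-bijection t t (inj₂ t²≈-1))

  t[tz]≈-z : ∀ z → + t *ᶻ (+ t *ᶻ z) ≈ - z
  t[tz]≈-z z = begin
    + t *ᶻ (+ t *ᶻ z)    ≡⟨ ℤₚ.*-assoc (+ t) (+ t) z ⟨
    + t *ᶻ + t *ᶻ z      ≡⟨ cong (_*ᶻ z) (ℤₚ.pos-* t t) ⟨
    + (t * t) *ᶻ z       ≈⟨ *-cong t²≈-1 (≈-refl {z}) ⟩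
    - + 1 *ᶻ z           ≡⟨ ℤₚ.-1*i≡-i z ⟩
    - z                  ∎
    where open ≈-Reasoning

  f-fixedPointFree : ∀ {x} → x ∈[1, h ] → x ≢ f x
  f-fixedPointFree {x} (1≤x , x≤h) x≡fx = ℕ.<⇒≢ 1≤x (sym (ℕ.m+n≡0⇒m≡0 x x+x≡0))
    where
    x≈±tx : + x ≈± + (t * x)
    x≈±tx = subst (λ y → + y ≈± + (t * x)) (sym x≡fx) (tilde-≈± (t * x))
    -- x ≡ ±tx forces t(tx) ≡ x, whereas t² ≡ -1 gives t(tx) ≡ -x.
    t[tx]≈x : + t *ᶻ (+ t *ᶻ + x) ≈ + x
    t[tx]≈x with x≈±tx
    ... | inj₁ x≈tx  = ≈-trans (*-cong (≈-refl {+ t}) tx≈x) tx≈x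
      where tx≈x = ≈-trans (≈-reflexive (sym (ℤₚ.pos-* t x))) (≈-sym x≈tx)
    ... | inj₂ x≈-tx = begin
      + t *ᶻ (+ t *ᶻ + x)  ≈⟨ *-cong (≈-refl {+ t}) tx≈-x ⟩
      + t *ᶻ - + x         ≡⟨ ℤₚ.neg-distribʳ-* (+ t) (+ x) ⟨
      - (+ t *ᶻ + x)       ≈⟨ neg-cong tx≈-x ⟩
      - - + x              ≡⟨ ℤₚ.neg-involutive (+ x) ⟩
      + x                  ∎
      where
      open ≈-Reasoning
      tx≈-x : + t *ᶻ + x ≈ - + x
      tx≈-x = begin
        + t *ᶻ + x      ≡⟨ ℤₚ.pos-* t x ⟨
        + (t * x)       ≡⟨ ℤₚ.neg-involutive (+ (t * x)) ⟨
        - - + (t * x)   ≈⟨ neg-cong (≈-sym x≈-tx) ⟩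
        - + x           ∎
    x+x≡0 : x + x ≡ 0
    x+x≡0 = ≈-neg⇒sum≡0 x≤h x≤h (≈-trans (≈-sym t[tx]≈x) (t[tz]≈-z (+ x)))

  g : ℕ → ℕ
  g x = tilde p (suc t * x)

  -- (h + 1)(1 + 2ht) ≡ 2⁻¹ (1 - t) and (1 + t)(1 - t) = 1 - t² ≡ 2.
  c : ℕ
  c = suc h * suc ((h + h) * t)

  g⁻¹ : ℕ → ℕ
  g⁻¹ x = tilde p (c * x)

  [1+t]c≈1 : + (suc t * c) ≈ + 1
  [1+t]c≈1 = begin
    + (suc t * c)                                       ≈⟨ ≈-sym (+-multiple-≈ (suc t * c) h) ⟩
    + (suc t * c + h * p)                               ≡⟨ cong +_ (expand h t) ⟩
    + (1 + (h + h) * suc h * (t * t + 1) + suc h * t * p) ≈⟨ +-multiple-≈ _ (suc h * t) ⟩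
    + (1 + (h + h) * suc h * (t * t + 1))               ≡⟨ ℤₚ.pos-+ 1 _ ⟩
    + 1 +ᶻ + ((h + h) * suc h * (t * t + 1))            ≡⟨ cong (+ 1 +ᶻ_) (ℤₚ.pos-* ((h + h) * suc h) (t * t + 1)) ⟩
    + 1 +ᶻ + ((h + h) * suc h) *ᶻ + (t * t + 1)         ≈⟨ +-cong (≈-refl {+ 1}) (*-cong (≈-refl {+ ((h + h) * suc h)}) t²+1≈0) ⟩
    + 1 +ᶻ + ((h + h) * suc h) *ᶻ + 0                   ≡⟨ cong (+ 1 +ᶻ_) (ℤₚ.*-zeroʳ (+ ((h + h) * suc h))) ⟩
    + 1                                                 ∎
    where
    open ≈-Reasoning
    expand : ∀ h t → suc t * (suc h * suc ((h + h) * t)) + h * suc (h + h)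
                   ≡ 1 + (h + h) * suc h * (t * t + 1) + suc h * t * suc (h + h)
    expand = ℕ-Solver.solve-∀
    t²+1≈0 : + (t * t + 1) ≈ + 0
    t²+1≈0 = ≈-trans (≈-reflexive (ℤₚ.pos-+ (t * t) 1)) (+-cong t²≈-1 (≈-refl {+ 1}))

  g-bijection : IsBijectionOn h g g⁻¹
  g-bijection = multiplier-bijection (suc t) c (inj₁ [1+t]c≈1)

  [1+t]z≡ : ∀ z → + (suc t * z) ≡ + z +ᶻ + t *ᶻ + z
  [1+t]z≡ z = trans (ℤₚ.pos-+ z (t * z)) (cong (+ z +ᶻ_) (ℤₚ.pos-* t z))

  ∣-∣≈± : ∀ x y → + ∣ x - y ∣ ≈± + y - + x
  ∣-∣≈± x y with ℕ.≤-total x y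
  ... | inj₁ x≤y = inj₁ (≈-reflexive (begin
    + ∣ x - y ∣   ≡⟨ cong +_ (ℕ.m≤n⇒∣m-n∣≡n∸m x≤y) ⟩
    + (y ∸ x)     ≡⟨ ℤₚ.≤-⊖ x≤y ⟨
    y ℤ.⊖ x       ≡⟨ ℤₚ.m-n≡m⊖n y x ⟨
    + y - + x     ∎))
    where open ≡-Reasoning
  ... | inj₂ y≤x = inj₂ (≈-reflexive (begin
    + ∣ x - y ∣   ≡⟨ cong +_ (ℕ.m≤n⇒∣n-m∣≡n∸m y≤x) ⟩
    + (x ∸ y)     ≡⟨ ℤₚ.≤-⊖ y≤x ⟨
    x ℤ.⊖ y       ≡⟨ ℤₚ.⊖-swap x y ⟩
    - (y ℤ.⊖ x)   ≡⟨ cong -_ (ℤₚ.m-n≡m⊖n y x) ⟨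
    - (+ y - + x) ∎))
    where open ≡-Reasoning

  ∣-∣≤h : ∀ {x y} → x ≤ h → y ≤ h → ∣ x - y ∣ ≤ h
  ∣-∣≤h {x} {y} x≤h y≤h = ℕ.≤-trans (ℕ.∣m-n∣≤m⊔n x y) (ℕ.⊔-lub x≤h y≤h)

  pair-image⁺ : ∀ {x} → x ≤ h → + f x ≈ + (t * x) →
                g x ≡ tilde p (x + f x) × g (f x) ≡ ∣ x - f x ∣
  pair-image⁺ {x} x≤h fx≈tx = gx≡ , gfx≡
    where
    open ≈-Reasoning
    gx≡ : g x ≡ tilde p (x + f x)
    gx≡ = tilde-cong (x + f x) (begin
      + (suc t * x)            ≡⟨ ℤₚ.pos-+ x (t * x) ⟩
      + x +ᶻ + (t * x)         ≈⟨ +-cong (≈-refl {+ x}) (≈-sym fx≈tx) ⟩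
      + x +ᶻ + f x             ≡⟨ ℤₚ.pos-+ x (f x) ⟨
      + (x + f x)              ∎)
    [1+t]fx≈fx-x : + (suc t * f x) ≈ + f x - + x
    [1+t]fx≈fx-x = begin
      + (suc t * f x)                ≡⟨ [1+t]z≡ (f x) ⟩
      + f x +ᶻ + t *ᶻ + f x          ≈⟨ +-cong (≈-refl {+ f x}) (*-cong (≈-refl {+ t}) fx≈t*x) ⟩
      + f x +ᶻ + t *ᶻ (+ t *ᶻ + x)   ≈⟨ +-cong (≈-refl {+ f x}) (t[tz]≈-z (+ x)) ⟩
      + f x - + x                    ∎
      where fx≈t*x = ≈-trans fx≈tx (≈-reflexive (ℤₚ.pos-* t x))
    gfx≡ : g (f x) ≡ ∣ x - f x ∣
    gfx≡ = tilde-unique (suc t * f x) (∣-∣≤h x≤h (tilde≤h (t * x)))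
                        (≈±-trans (∣-∣≈± x (f x)) (≈±-sym (inj₁ [1+t]fx≈fx-x)))

  pair-image⁻ : ∀ {x} → x ≤ h → + f x ≈ - + (t * x) →
                g x ≡ ∣ x - f x ∣ × g (f x) ≡ tilde p (x + f x)
  pair-image⁻ {x} x≤h fx≈-tx = gx≡ , gfx≡
    where
    open ≈-Reasoning
    tx≈-fx : + (t * x) ≈ - + f x
    tx≈-fx = ≈-trans (≈-reflexive (sym (ℤₚ.neg-involutive _))) (neg-cong (≈-sym fx≈-tx))
    [1+t]x≈-[fx-x] : + (suc t * x) ≈ - (+ f x - + x)
    [1+t]x≈-[fx-x] = begin
      + (suc t * x)            ≡⟨ ℤₚ.pos-+ x (t * x) ⟩
      + x +ᶻ + (t * x)         ≈⟨ +-cong (≈-refl {+ x}) tx≈-fx ⟩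
      + x +ᶻ - + f x           ≡⟨ rearrange (+ x) (+ f x) ⟩
      - (+ f x - + x)          ∎
      where rearrange : ∀ a b → a +ᶻ - b ≡ - (b - a)
            rearrange = solve-∀
    gx≡ : g x ≡ ∣ x - f x ∣
    gx≡ = tilde-unique (suc t * x) (∣-∣≤h x≤h (tilde≤h (t * x)))
                       (≈±-trans (∣-∣≈± x (f x)) (≈±-sym (inj₂ [1+t]x≈-[fx-x])))
    gfx≡ : g (f x) ≡ tilde p (x + f x)
    gfx≡ = tilde-cong (x + f x) (begin
      + (suc t * f x)                  ≡⟨ [1+t]z≡ (f x) ⟩
      + f x +ᶻ + t *ᶻ + f x            ≈⟨ +-cong (≈-refl {+ f x}) (*-cong (≈-refl {+ t}) fx≈-t*x) ⟩
      + f x +ᶻ + t *ᶻ - (+ t *ᶻ + x)   ≡⟨ cong (+ f x +ᶻ_) (ℤₚ.neg-distribʳ-* (+ t) (+ t *ᶻ + x)) ⟨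
      + f x +ᶻ - (+ t *ᶻ (+ t *ᶻ + x)) ≈⟨ +-cong (≈-refl {+ f x}) (neg-cong (t[tz]≈-z (+ x))) ⟩
      + f x +ᶻ - - + x                 ≡⟨ cong (+ f x +ᶻ_) (ℤₚ.neg-involutive (+ x)) ⟩
      + f x +ᶻ + x                     ≡⟨ ℤₚ.+-comm (+ f x) (+ x) ⟩
      + x +ᶻ + f x                     ≡⟨ ℤₚ.pos-+ x (f x) ⟨
      + (x + f x)                      ∎)
      where fx≈-t*x = ≈-trans fx≈-tx (≈-reflexive (cong -_ (ℤₚ.pos-* t x)))

  g-pair : ∀ {x} → x ∈[1, h ] →
             (g x ≡ ∣ x - f x ∣ × g (f x) ≡ tilde p (x + f x))
           ⊎ (g x ≡ tilde p (x + f x) × g (f x) ≡ ∣ x - f x ∣)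
  g-pair {x} (_ , x≤h) with tilde-≈± (t * x)
  ... | inj₁ fx≈tx  = inj₂ (pair-image⁺ x≤h fx≈tx)
  ... | inj₂ fx≈-tx = inj₁ (pair-image⁻ x≤h fx≈-tx)

same-parity : ∀ a b k c → a + b + k * 2 ≡ c * 2 → b % 2 ≡ a % 2
same-parity a b k c a+b+2k≡2c = begin
  b % 2                        ≡⟨ [m+kn]%n≡m%n b (a + k) 2 ⟨
  (b + (a + k) * 2) % 2  ≡⟨ cong (_% 2) (trans (regroup a b k) (cong (a +_) a+b+2k≡2c)) ⟩
  (a + c * 2) % 2          ≡⟨ [m+kn]%n≡m%n a c 2 ⟩
  a % 2                        ∎
  where
  open ≡-Reasoning
  regroup : ∀ a b k → b + (a + k) * 2 ≡ a + (a + b + k * 2)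
  regroup = ℕ-Solver.solve-∀

module PairedSums (h : ℕ) {f g g⁻¹ : ℕ → ℕ}
  (f-involution : IsInvolutionOn h f)
  (f-fixedPointFree : ∀ {x} → x ∈[1, h ] → x ≢ f x)
  (g-bijection : IsBijectionOn h g g⁻¹)
  (g-pair : ∀ {x} → x ∈[1, h ] →
              (g x ≡ ∣ x - f x ∣ × g (f x) ≡ tilde (suc (h + h)) (x + f x))
            ⊎ (g x ≡ tilde (suc (h + h)) (x + f x) × g (f x) ≡ ∣ x - f x ∣)) where

  open OddModulus h using (p; tilde-small; tilde-large)
  open ℕ-Sum
  open IsInvolutionOn f-involution using (involutive) renaming (isBijectionOn to f-bijection)

  below : (ℕ → ℕ) → ℕ → ℕ
  below F x = when (x <? f x) (F x)

  s : ℕ → ℕ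
  s x = x + f x

  -- Selects the x whose residue (x + f x)~ is p - (x + f x).
  carry : (ℕ → ℕ) → ℕ → ℕ
  carry F x = when (p <? 2 * s x) (F x)

  I Q S T X : ℕ
  I = ∑ h (λ x → x)
  Q = ∑ h (λ x → x * x)
  S = ∑ h (below (λ x → x))
  T = ∑ h (below f)
  X = ∑ h (λ x → x * f x)

  ∑-+-scale : ∀ (F G : ℕ → ℕ) c → ∑ h (λ x → F x + c * G x) ≡ ∑ h F + c * ∑ h G
  ∑-+-scale F G c = trans (∑-distrib h F (λ x → c * G x)) (cong (∑ h F +_) (sym (*-distribˡ-∑ c h G)))

  ∑∘f : ∀ F → ∑ h (λ x → F (f x)) ≡ ∑ h F
  ∑∘f F = ∑-reindex h F f-bijection

  ∑-involutive-pair : ∀ F → ∑ h (λ x → F x + F (f x)) ≡ ∑ h F + ∑ h F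
  ∑-involutive-pair F = trans (∑-distrib h F (λ x → F (f x))) (cong (∑ h F +_) (∑∘f F))

  s∘f≡s : ∀ {x} → x ∈[1, h ] → s (f x) ≡ s x
  s∘f≡s {x} x∈ = trans (cong (f x +_) (involutive x∈)) (ℕ.+-comm (f x) x)

  ∑-symmetric-twice : ∀ F → (∀ {x} → x ∈[1, h ] → F (f x) ≡ F x) → ∑ h F ≡ 2 * ∑ h (below F)
  ∑-symmetric-twice F F∘f≡F =
    trans (∑-symmetric h F f-involution f-fixedPointFree F∘f≡F)
          (cong (∑ h (below F) +_) (sym (ℕ.+-identityʳ _)))

  D E : ℕ → ℕ
  D x = ∣ x - f x ∣
  E x = tilde p (s x)

  s≤p : ∀ {x} → x ∈[1, h ] → s x ≤ p
  s≤p x∈ = ℕ.m≤n⇒m≤1+n (ℕ.+-mono-≤ (proj₂ x∈) (proj₂ (IsInvolutionOn.closed f-involution x∈)))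

  ∑-min≡2S : ∑ h (λ x → x ⊓ f x) ≡ 2 * S
  ∑-min≡2S = trans (∑-symmetric-twice (λ x → x ⊓ f x) min∘f≡min) (cong (2 *_) (∑-cong h below-min))
    where
    min∘f≡min : ∀ {x} → x ∈[1, h ] → f x ⊓ f (f x) ≡ x ⊓ f x
    min∘f≡min {x} x∈ = trans (cong (f x ⊓_) (involutive x∈)) (ℕ.⊓-comm (f x) x)
    below-min : ∀ x → x ∈[1, h ] → below (λ x → x ⊓ f x) x ≡ below (λ x → x) x
    below-min x _ with x <? f x
    ... | yes x<fx = ℕ.m≤n⇒m⊓n≡m (ℕ.<⇒≤ x<fx)
    ... | no _     = refl

  ∸+2*≡+ : ∀ {m n} → m ≤ n → (n ∸ m) + 2 * m ≡ n + m
  ∸+2*≡+ {m} {n} m≤n = trans (regroup (n ∸ m) m) (cong (_+ m) (ℕ.m∸n+n≡m m≤n))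
    where regroup : ∀ d m → d + 2 * m ≡ d + m + m
          regroup = ℕ-Solver.solve-∀

  ∣-∣+2⊓≡+ : ∀ x y → ∣ x - y ∣ + 2 * (x ⊓ y) ≡ x + y
  ∣-∣+2⊓≡+ x y with ℕ.≤-total x y
  ... | inj₁ x≤y = begin
    ∣ x - y ∣ + 2 * (x ⊓ y)   ≡⟨ cong₂ (λ a b → a + 2 * b) (ℕ.m≤n⇒∣m-n∣≡n∸m x≤y) (ℕ.m≤n⇒m⊓n≡m x≤y) ⟩
    (y ∸ x) + 2 * x           ≡⟨ ∸+2*≡+ x≤y ⟩
    y + x                     ≡⟨ ℕ.+-comm y x ⟩
    x + y                     ∎
    where open ≡-Reasoning
  ... | inj₂ y≤x = trans (cong₂ (λ a b → a + 2 * b) (ℕ.m≤n⇒∣n-m∣≡n∸m y≤x) (ℕ.m≥n⇒m⊓n≡n y≤x))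
                         (∸+2*≡+ y≤x)

  ∑D+4S≡2I : ∑ h D + 2 * (2 * S) ≡ I + I
  ∑D+4S≡2I = begin
    ∑ h D + 2 * (2 * S)                       ≡⟨ cong (λ m → ∑ h D + 2 * m) ∑-min≡2S ⟨
    ∑ h D + 2 * ∑ h (λ x → x ⊓ f x)           ≡⟨ ∑-+-scale D (λ x → x ⊓ f x) 2 ⟨
    ∑ h (λ x → D x + 2 * (x ⊓ f x))           ≡⟨ ∑-cong h (λ x _ → ∣-∣+2⊓≡+ x (f x)) ⟩
    ∑ h s                                     ≡⟨ ∑-involutive-pair (λ x → x) ⟩
    I + I                                     ∎
    where open ≡-Reasoning

  -- As x runs over [1,h], both {g x, g (f x)} and {D x, E x} run over [1,h] twice.
  ∑-D-E : ∀ G → ∑ h (λ x → G (D x) + G (E x)) ≡ ∑ h G + ∑ h G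
  ∑-D-E G = begin
    ∑ h (λ x → G (D x) + G (E x))             ≡⟨ ∑-cong h pair ⟨
    ∑ h (λ x → G (g x) + G (g (f x)))         ≡⟨ ∑-involutive-pair (λ x → G (g x)) ⟩
    ∑ h (λ x → G (g x)) + ∑ h (λ x → G (g x)) ≡⟨ cong₂ _+_ ∑G∘g ∑G∘g ⟩
    ∑ h G + ∑ h G                             ∎
    where
    open ≡-Reasoning
    ∑G∘g = ∑-reindex h G g-bijection
    pair : ∀ x → x ∈[1, h ] → G (g x) + G (g (f x)) ≡ G (D x) + G (E x)
    pair x x∈ with g-pair x∈
    ... | inj₁ (gx≡D , gfx≡E) = cong₂ (λ u v → G u + G v) gx≡D gfx≡E
    ... | inj₂ (gx≡E , gfx≡D) = trans (cong₂ (λ u v → G u + G v) gx≡E gfx≡D) (ℕ.+-comm (G (E x)) (G (D x)))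

  E+2carry : ∀ {x} → x ∈[1, h ] → E x + 2 * carry s x ≡ s x + p * carry (λ _ → 1) x
  E+2carry {x} x∈ with p <? 2 * s x
  ... | yes p<2s = begin
    E x + 2 * s x             ≡⟨ cong (_+ 2 * s x) (tilde-large (s x) (s≤p x∈) p<2s) ⟩
    (p ∸ s x) + 2 * s x       ≡⟨ regroup (p ∸ s x) (s x) ⟩
    s x + ((p ∸ s x) + s x) * 1 ≡⟨ cong (λ q → s x + q * 1) (ℕ.m∸n+n≡m (s≤p x∈)) ⟩
    s x + p * 1               ∎
    where
    open ≡-Reasoning
    regroup : ∀ r s → r + 2 * s ≡ s + (r + s) * 1
    regroup = ℕ-Solver.solve-∀
  ... | no p≮2s = cong₂ _+_ (tilde-small (s x) p≮2s) (sym (ℕ.*-zeroʳ p))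

  E²+2pcarry : ∀ {x} → x ∈[1, h ] → E x * E x + 2 * p * carry s x ≡ s x * s x + p * p * carry (λ _ → 1) x
  E²+2pcarry {x} x∈ with p <? 2 * s x
  ... | yes p<2s = begin
    E x * E x + 2 * p * s x                 ≡⟨ cong (λ e → e * e + 2 * p * s x) (tilde-large (s x) (s≤p x∈) p<2s) ⟩
    (p ∸ s x) * (p ∸ s x) + 2 * p * s x     ≡⟨ cong (λ q → (p ∸ s x) * (p ∸ s x) + 2 * q * s x) p≡r+s ⟩
    r * r + 2 * (r + s x) * s x             ≡⟨ square (p ∸ s x) (s x) ⟩
    s x * s x + (r + s x) * (r + s x) * 1   ≡⟨ cong (λ q → s x * s x + q * q * 1) p≡r+s ⟨
    s x * s x + p * p * 1                   ∎
    where
    open ≡-Reasoning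
    r = p ∸ s x
    p≡r+s = sym (ℕ.m∸n+n≡m (s≤p x∈))
    square : ∀ r s → r * r + 2 * (r + s) * s ≡ s * s + (r + s) * (r + s) * 1
    square = ℕ-Solver.solve-∀
  ... | no p≮2s = cong₂ (λ e z → e * e + z) (tilde-small (s x) p≮2s) (trans (ℕ.*-zeroʳ (2 * p)) (sym (ℕ.*-zeroʳ (p * p))))

  gap²+2mn≡m²+n² : ∀ {m n} → m ≤ n → (n ∸ m) * (n ∸ m) + 2 * (m * n) ≡ m * m + n * n
  gap²+2mn≡m²+n² {m} {n} m≤n =
    subst (λ k → (n ∸ m) * (n ∸ m) + 2 * (m * k) ≡ m * m + k * k) (ℕ.m∸n+n≡m m≤n) (expand (n ∸ m) m)
    where expand : ∀ d m → d * d + 2 * (m * (d + m)) ≡ m * m + (d + m) * (d + m)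
          expand = ℕ-Solver.solve-∀

  D²+2xfx≡x²+fx² : ∀ x → D x * D x + 2 * (x * f x) ≡ x * x + f x * f x
  D²+2xfx≡x²+fx² x with ℕ.≤-total x (f x)
  ... | inj₁ x≤fx = trans (cong (λ d → d * d + 2 * (x * f x)) (ℕ.m≤n⇒∣m-n∣≡n∸m x≤fx)) (gap²+2mn≡m²+n² x≤fx)
  ... | inj₂ fx≤x = begin
    D x * D x + 2 * (x * f x)              ≡⟨ cong₂ (λ d m → d * d + 2 * m) (ℕ.m≤n⇒∣n-m∣≡n∸m fx≤x) (ℕ.*-comm x (f x)) ⟩
    (x ∸ f x) * (x ∸ f x) + 2 * (f x * x)  ≡⟨ gap²+2mn≡m²+n² fx≤x ⟩
    f x * f x + x * x                      ≡⟨ ℕ.+-comm (f x * f x) (x * x) ⟩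
    x * x + f x * f x                      ∎
    where open ≡-Reasoning

  Ws N : ℕ
  Ws = ∑ h (carry s)
  N  = ∑ h (carry (λ _ → 1))

  ∑E≡4S : ∑ h E ≡ 2 * (2 * S)
  ∑E≡4S = ℕ.+-cancelˡ-≡ (∑ h D) _ _
    (trans (sym (∑-distrib h D E)) (trans (∑-D-E (λ x → x)) (sym ∑D+4S≡2I)))

  ∑E²≡2X : ∑ h (λ x → E x * E x) ≡ 2 * X
  ∑E²≡2X = ℕ.+-cancelˡ-≡ (∑ h (λ x → D x * D x)) _ _ (begin
    ∑ h (λ x → D x * D x) + ∑ h (λ x → E x * E x) ≡⟨ ∑-distrib h _ _ ⟨
    ∑ h (λ x → D x * D x + E x * E x)             ≡⟨ ∑-D-E (λ x → x * x) ⟩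
    Q + Q                                         ≡⟨ ∑-involutive-pair (λ x → x * x) ⟨
    ∑ h (λ x → x * x + f x * f x)                 ≡⟨ ∑-cong h (λ x _ → D²+2xfx≡x²+fx² x) ⟨
    ∑ h (λ x → D x * D x + 2 * (x * f x))         ≡⟨ ∑-+-scale (λ x → D x * D x) (λ x → x * f x) 2 ⟩
    ∑ h (λ x → D x * D x) + 2 * X                 ∎)
    where open ≡-Reasoning

  ∑s²≡2Q+2X : ∑ h (λ x → s x * s x) ≡ Q + Q + 2 * X
  ∑s²≡2Q+2X = begin
    ∑ h (λ x → s x * s x)                          ≡⟨ ∑-cong h (λ x _ → binomial x (f x)) ⟩
    ∑ h (λ x → (x * x + f x * f x) + 2 * (x * f x)) ≡⟨ ∑-+-scale (λ x → x * x + f x * f x) (λ x → x * f x) 2 ⟩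
    ∑ h (λ x → x * x + f x * f x) + 2 * X          ≡⟨ cong (_+ 2 * X) (∑-involutive-pair (λ x → x * x)) ⟩
    Q + Q + 2 * X                                  ∎
    where
    open ≡-Reasoning
    binomial : ∀ a b → (a + b) * (a + b) ≡ (a * a + b * b) + 2 * (a * b)
    binomial = ℕ-Solver.solve-∀

  4S+2Ws≡2I+pN : 2 * (2 * S) + 2 * Ws ≡ (I + I) + p * N
  4S+2Ws≡2I+pN = begin
    2 * (2 * S) + 2 * Ws           ≡⟨ cong (_+ 2 * Ws) ∑E≡4S ⟨
    ∑ h E + 2 * Ws                 ≡⟨ ∑-+-scale E (carry s) 2 ⟨
    ∑ h (λ x → E x + 2 * carry s x) ≡⟨ ∑-cong h (λ _ x∈ → E+2carry x∈) ⟩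
    ∑ h (λ x → s x + p * carry (λ _ → 1) x) ≡⟨ ∑-+-scale s (carry (λ _ → 1)) p ⟩
    ∑ h s + p * N                  ≡⟨ cong (_+ p * N) (∑-involutive-pair (λ x → x)) ⟩
    (I + I) + p * N                ∎
    where open ≡-Reasoning

  2pWs≡2Q+p²N : 2 * p * Ws ≡ (Q + Q) + p * p * N
  2pWs≡2Q+p²N = ℕ.+-cancelˡ-≡ (2 * X) _ _ (begin
    2 * X + 2 * p * Ws                            ≡⟨ cong (_+ 2 * p * Ws) ∑E²≡2X ⟨
    ∑ h (λ x → E x * E x) + 2 * p * Ws            ≡⟨ ∑-+-scale (λ x → E x * E x) (carry s) (2 * p) ⟨
    ∑ h (λ x → E x * E x + 2 * p * carry s x)     ≡⟨ ∑-cong h (λ _ x∈ → E²+2pcarry x∈) ⟩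
    ∑ h (λ x → s x * s x + p * p * carry (λ _ → 1) x) ≡⟨ ∑-+-scale (λ x → s x * s x) (carry (λ _ → 1)) (p * p) ⟩
    ∑ h (λ x → s x * s x) + p * p * N             ≡⟨ cong (_+ p * p * N) ∑s²≡2Q+2X ⟩
    Q + Q + 2 * X + p * p * N                     ≡⟨ regroup Q X (p * p * N) ⟩
    2 * X + ((Q + Q) + p * p * N)                 ∎)
    where
    open ≡-Reasoning
    regroup : ∀ Q X M → Q + Q + 2 * X + M ≡ 2 * X + ((Q + Q) + M)
    regroup = ℕ-Solver.solve-∀

  -- p times the first carry identity minus the second one: the carries cancel.
  4pS+2Q≡2pI : 2 * (2 * p * S) + (Q + Q) ≡ 2 * (p * I)
  4pS+2Q≡2pI = ℕ.+-cancelʳ-≡ (p * p * N) _ _ (begin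
    2 * (2 * p * S) + (Q + Q) + p * p * N    ≡⟨ regroup₁ p S (Q + Q) (p * p * N) ⟩
    4 * p * S + ((Q + Q) + p * p * N)        ≡⟨ cong (4 * p * S +_) 2pWs≡2Q+p²N ⟨
    4 * p * S + 2 * p * Ws                   ≡⟨ regroup₂ p S Ws ⟩
    p * (2 * (2 * S) + 2 * Ws)               ≡⟨ cong (p *_) 4S+2Ws≡2I+pN ⟩
    p * ((I + I) + p * N)                    ≡⟨ regroup₃ p I N ⟩
    2 * (p * I) + p * p * N                  ∎)
    where
    open ≡-Reasoning
    regroup₁ : ∀ p S Q M → 2 * (2 * p * S) + Q + M ≡ 4 * p * S + (Q + M)
    regroup₁ = ℕ-Solver.solve-∀
    regroup₂ : ∀ p S W → 4 * p * S + 2 * p * W ≡ p * (2 * (2 * S) + 2 * W)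
    regroup₂ = ℕ-Solver.solve-∀
    regroup₃ : ∀ p I N → p * ((I + I) + p * N) ≡ 2 * (p * I) + p * p * N
    regroup₃ = ℕ-Solver.solve-∀

  3Q≡pI : 3 * Q ≡ p * I
  3Q≡pI = ℕ.*-cancelˡ-≡ (3 * Q) (p * I) 2 (begin
    2 * (3 * Q)               ≡⟨ ℕ.*-assoc 2 3 Q ⟨
    6 * Q                     ≡⟨ ∑-square h ⟩
    h * suc h * (1 + 2 * h)   ≡⟨ cong (_* (1 + 2 * h)) (∑-identity h) ⟨
    2 * I * (1 + 2 * h)       ≡⟨ regroup h I ⟩
    2 * (p * I)               ∎)
    where
    open ≡-Reasoning
    regroup : ∀ h I → 2 * I * (1 + 2 * h) ≡ 2 * (suc (h + h) * I)
    regroup = ℕ-Solver.solve-∀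

  3S≡I : 3 * S ≡ I
  3S≡I = ℕ.*-cancelˡ-≡ (3 * S) I (4 * p) (ℕ.+-cancelʳ-≡ (2 * (p * I)) _ _ (begin
    4 * p * (3 * S) + 2 * (p * I)    ≡⟨ cong (λ z → 4 * p * (3 * S) + 2 * z) 3Q≡pI ⟨
    4 * p * (3 * S) + 2 * (3 * Q)    ≡⟨ regroup₁ p S Q ⟩
    3 * (2 * (2 * p * S) + (Q + Q))  ≡⟨ cong (3 *_) 4pS+2Q≡2pI ⟩
    3 * (2 * (p * I))                ≡⟨ regroup₂ p I ⟩
    4 * p * I + 2 * (p * I)          ∎))
    where
    open ≡-Reasoning
    regroup₁ : ∀ p S Q → 4 * p * (3 * S) + 2 * (3 * Q) ≡ 3 * (2 * (2 * p * S) + (Q + Q))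
    regroup₁ = ℕ-Solver.solve-∀
    regroup₂ : ∀ p I → 3 * (2 * (p * I)) ≡ 4 * p * I + 2 * (p * I)
    regroup₂ = ℕ-Solver.solve-∀

  3T≡2I : 3 * T ≡ 2 * I
  3T≡2I = ℕ.+-cancelˡ-≡ I _ _ (begin
    I + 3 * T          ≡⟨ cong (_+ 3 * T) 3S≡I ⟨
    3 * S + 3 * T      ≡⟨ ℕ.*-distribˡ-+ 3 S T ⟨
    3 * (S + T)        ≡⟨ cong (3 *_) (∑-fixedPointFree h (λ x → x) f-involution f-fixedPointFree) ⟨
    3 * I              ≡⟨⟩
    I + 2 * I          ∎)
    where open ≡-Reasoning

  V₂-parity : ∑ h (below (carry (λ _ → 1))) % 2 ≡ I % 2
  V₂-parity = same-parity I card-V₂ (h * card-V₂) (S + sum-s-V₂) (ℕ.*-cancelˡ-≡ _ _ 2 (begin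
    2 * (I + card-V₂ + h * card-V₂ * 2) ≡⟨ regroup₁ h I card-V₂ ⟩
    (I + I) + p * (2 * card-V₂)       ≡⟨ cong (λ n → (I + I) + p * n) N≡2V ⟨
    (I + I) + p * N                  ≡⟨ 4S+2Ws≡2I+pN ⟨
    2 * (2 * S) + 2 * Ws             ≡⟨ cong (λ w → 2 * (2 * S) + 2 * w) Ws≡2W ⟩
    2 * (2 * S) + 2 * (2 * sum-s-V₂) ≡⟨ regroup₂ S sum-s-V₂ ⟩
    2 * ((S + sum-s-V₂) * 2)         ∎))
    where
    open ≡-Reasoning
    card-V₂ sum-s-V₂ : ℕ
    card-V₂  = ∑ h (below (carry (λ _ → 1)))
    sum-s-V₂ = ∑ h (below (carry s))
    N≡2V : N ≡ 2 * card-V₂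
    N≡2V = ∑-symmetric-twice (carry (λ _ → 1)) (λ x∈ → cong (λ z → when (p <? 2 * z) 1) (s∘f≡s x∈))
    Ws≡2W : Ws ≡ 2 * sum-s-V₂
    Ws≡2W = ∑-symmetric-twice (carry s) (λ x∈ → cong (λ z → when (p <? 2 * z) z) (s∘f≡s x∈))
    regroup₁ : ∀ h I V → 2 * (I + V + h * V * 2) ≡ (I + I) + suc (h + h) * (2 * V)
    regroup₁ = ℕ-Solver.solve-∀
    regroup₂ : ∀ S W → 2 * (2 * S) + 2 * (2 * W) ≡ 2 * ((S + W) * 2)
    regroup₂ = ℕ-Solver.solve-∀

module OneModFour (k : ℕ) (p-prime : Prime (suc (2 * k + 2 * k))) where

  open import Data.Integer using (+_; -_; _^_) renaming (_*_ to _*ᶻ_)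

  h p : ℕ
  h = 2 * k
  p = suc (h + h)

  open Modular p
  open ℕ-Sum

  half≡h : half p ≡ h
  half≡h = trans (cong (_/ 2) (trans (cong (λ n → h + n) (sym (ℕ.+-identityʳ h))) (ℕ.*-comm 2 h)))
                 (m*n/n≡m h 2)

  -- Wilson's theorem and h even give t² ≡ -1 for t = h!.
  t²≈-1 : + (tval p * tval p) ≈ - + 1
  t²≈-1 = begin
    + (tval p * tval p)              ≡⟨ cong (λ n → + (n ! * n !)) half≡h ⟩
    + (h ! * h !)                    ≡⟨ ℤₚ.*-identityˡ (+ (h ! * h !)) ⟨
    + 1 *ᶻ + (h ! * h !)             ≡⟨ cong (_*ᶻ + (h ! * h !)) (trans (sym (ℤₚ.^-*-assoc (- + 1) 2 k)) (ℤₚ.^-zeroˡ k)) ⟨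
    (- + 1) ^ h *ᶻ + (h ! * h !)     ≈⟨ ≈-sym (OddModulus.factorial-reflection h) ⟩
    + ((h + h) !)                    ≈⟨ Wilson.wilson p p-prime ⟩
    - + 1                            ∎
    where open ≈-Reasoning

  open SquareRootOfMinusOne h (tval p) t²≈-1
  open PairedSums h f-involution f-fixedPointFree g-bijection g-pair

  range1h≡ : range1h p ≡ map suc (upTo h)
  range1h≡ = cong (λ n → map suc (upTo n)) half≡h

  sum-V≡S : sum (V p) ≡ S
  sum-V≡S = begin
    sum (V p)                                             ≡⟨ cong sum (map-id (V p)) ⟨
    sum (map (λ x → x) (V p))                             ≡⟨ sum-filter (λ x → x <? f x) (λ x → x) (range1h p) ⟩
    sum (map (below (λ x → x)) (range1h p))               ≡⟨ cong (λ xs → sum (map (below (λ x → x)) xs)) range1h≡ ⟩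
    sum (map (below (λ x → x)) (map suc (upTo h)))        ≡⟨ sum-range h (below (λ x → x)) ⟩
    S                                                     ∎
    where open ≡-Reasoning

  sum-bar-V≡T : sum (map (bar p) (V p)) ≡ T
  sum-bar-V≡T = begin
    sum (map f (V p))                                     ≡⟨ sum-filter (λ x → x <? f x) f (range1h p) ⟩
    sum (map (below f) (range1h p))                       ≡⟨ cong (λ xs → sum (map (below f) xs)) range1h≡ ⟩
    sum (map (below f) (map suc (upTo h)))                ≡⟨ sum-range h (below f) ⟩
    T                                                     ∎
    where open ≡-Reasoning

  length-V₂ : length (V₂ p) ≡ ∑ h (below (carry (λ _ → 1)))
  length-V₂ = begin
    length (V₂ p)                                         ≡⟨ length-filter (λ a → p <? 2 * (a + f a)) (V p) ⟩
    sum (map (carry (λ _ → 1)) (V p))                     ≡⟨ sum-filter (λ x → x <? f x) (carry (λ _ → 1)) (range1h p) ⟩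
    sum (map (below (carry (λ _ → 1))) (range1h p))       ≡⟨ cong (λ xs → sum (map (below (carry (λ _ → 1))) xs)) range1h≡ ⟩
    sum (map (below (carry (λ _ → 1))) (map suc (upTo h))) ≡⟨ sum-range h (below (carry (λ _ → 1))) ⟩
    ∑ h (below (carry (λ _ → 1)))                         ∎
    where open ≡-Reasoning

  M≡I : M p ≡ I
  M≡I = trans (cong (_/ 8) p²-1≡8I) (m*n/n≡m I 8)
    where
    open ≡-Reasoning
    p²-1≡8I : p * p ∸ 1 ≡ I * 8
    p²-1≡8I = begin
      (h + h) + (h + h) * p       ≡⟨ regroup h ⟩
      h * suc h * 4               ≡⟨ cong (_* 4) (∑-identity h) ⟨
      2 * I * 4                   ≡⟨ ℕ.*-comm (2 * I) 4 ⟩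
      4 * (2 * I)                 ≡⟨ ℕ.*-assoc 4 2 I ⟨
      8 * I                       ≡⟨ ℕ.*-comm 8 I ⟩
      I * 8                       ∎
      where regroup : ∀ h → (h + h) + (h + h) * suc (h + h) ≡ h * suc h * 4
            regroup = ℕ-Solver.solve-∀

  3∑V≡M : 3 * sum (V p) ≡ M p
  3∑V≡M = trans (cong (3 *_) sum-V≡S) (trans 3S≡I (sym M≡I))

  3∑bar-V≡2M : 3 * sum (map (bar p) (V p)) ≡ 2 * M p
  3∑bar-V≡2M = trans (cong (3 *_) sum-bar-V≡T) (trans 3T≡2I (cong (2 *_) (sym M≡I)))

  ∣V₂∣≡M-mod-2 : length (V₂ p) % 2 ≡ M p % 2
  ∣V₂∣≡M-mod-2 = trans (cong (_% 2) length-V₂) (trans V₂-parity (cong (_% 2) (sym M≡I)))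

p%4≡1⇒p≡1+4k : ∀ p → p % 4 ≡ 1 → p ≡ suc (2 * (p / 4) + 2 * (p / 4))
p%4≡1⇒p≡1+4k p p%4≡1 = trans (m≡m%n+[m/n]*n p 4) (cong₂ _+_ p%4≡1 (regroup (p / 4)))
  where regroup : ∀ k → k * 4 ≡ 2 * k + 2 * k
        regroup = ℕ-Solver.solve-∀

corollary2p5 : (p : ℕ) → .{{_ : NonZero p}} → Prime p → p % 4 ≡ 1 →
    ((3 * sum (V p) ≡ M p) × (3 * sum (map (bar p) (V p)) ≡ 2 * M p))
    × (length (V₂ p) % 2 ≡ M p % 2)
corollary2p5 p p-prime p%4≡1 with p / 4 | p%4≡1⇒p≡1+4k p p%4≡1
... | k | refl = (3∑V≡M , 3∑bar-V≡2M) , ∣V₂∣≡M-mod-2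
  where open OneModFour k p-prime
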